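{- Consider the two-party problem $\mathrm{DISJ}_n^{k,k'}$ in which Alice gets $k$ strings $\mathbf{x}_1,\dots,\mathbf{x}_k\in\{0,1\}^n$, Bob gets $k'$ strings $\mathbf{y}_1,\dots,\mathbf{y}_{k'}\in\{0,1\}^n$, and they must determine whether there is a pair $(i,j)$ with $\mathbf{x}_i=\mathbf{y}_j$. If $k,k'=2^{o(n)}$, then the deterministic two-party communication complexity of $\mathrm{DISJ}_n^{k,k'}$ is $\Omega(\min\{k,k'\}\cdot n)$. -}

module Defs where

open import Data.Nat using (ℕ; zero; suc; _⊔_; _≤_; _^_)
open import Data.Bool using (Bool; true; false; if_then_else_)
open import Data.Fin using (Fin)
open import Data.Vec using (Vec)
open import Data.Product using (∃; ∃-syntax; _×_)
open import Relation.Binary.PropositionalEquality using (_≡_)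
open import Function.Bundles using (_⇔_)

-- At an internal node the owner sends one bit
-- computed from its own input and the protocol continues in the
-- corresponding subtree (false-branch first, true-branch second).
data Protocol (X Y : Set) : Set where
  leaf  : Bool → Protocol X Y
  alice : (X → Bool) → Protocol X Y → Protocol X Y → Protocol X Y
  bob   : (Y → Bool) → Protocol X Y → Protocol X Y → Protocol X Y

run : {X Y : Set} → Protocol X Y → X → Y → Bool
run (leaf b)      x y = b
run (alice f p q) x y = if f x then run q x y else run p x y
run (bob g p q)   x y = if g y then run q x y else run p x y

cost : {X Y : Set} → Protocol X Y → ℕ
cost (leaf _)      = 0
cost (alice _ p q) = suc (cost p ⊔ cost q)
cost (bob _ p q)   = suc (cost p ⊔ cost q)

Strings : ℕ → ℕ → Set
Strings k n = Fin k → Vec Bool n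

Collide : {k k' n : ℕ} → Strings k n → Strings k' n → Set
Collide x y = ∃[ i ] ∃[ j ] (x i ≡ y j)

SolvesDISJ : {k k' n : ℕ} → Protocol (Strings k n) (Strings k' n) → Set
SolvesDISJ P = ∀ x y → (run P x y ≡ true) ⇔ Collide x y

-- f(n) = 2^{o(n)}: for every m, eventually f(n)^(m+1) ≤ 2^n,
-- i.e. log₂ f(n) ≤ n/(m+1) for all large n.
SubExp : (ℕ → ℕ) → Set
SubExp f = ∀ (m : ℕ) → ∃[ N ] (∀ n → N ≤ n → f n ^ suc m ≤ 2 ^ n)

module Submission where

-- Proof by the log-rank method over GF(2) (Booleans with xor and ∧).
-- 1. A protocol of cost c computes a matrix of GF(2)-rank ≤ 2^c: each entry is an
--    inner product ⟨α x , β y⟩ of vectors of length ≤ 2^c ('protocol-rank').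
-- 2. A matrix on {0,1}^N that is its own inverse over GF(2) has rank ≥ 2^N, by a
--    pigeonhole argument on bit vectors ('involution-rank').
-- 3. Reduction ('Embedding'): for K = 2^L and n = L + m, m ≥ 1, cut x ∈ {0,1}^(K·m)
--    into K blocks; the i-th string is the binary name of i followed by block i.
--    Two such families collide iff some block of x equals that of y, so a DISJ
--    protocol computes the complement of E(x , y) = ∏ⱼ [xⱼ ≠ yⱼ].  E is a tensor
--    power of J − I, and (J − I)² = I over GF(2) since 2^m is even; so cost ≥ K·m.
-- 4. With 2^L ≤ min(k,k') < 2^(L+1), the consequence k(n)² ≤ 2^n of k = 2^{o(n)}
--    gives 2L ≤ n, hence m = n − L ≥ n/2 and cost ≥ K·m ≥ min(k,k')·n/4.

open import Defs
open import Data.Nat using (ℕ; zero; suc; _+_; _*_; _∸_; _≤_; _<_; _⊓_; _⊔_; _^_; z≤n; s≤s; _<?_; NonZero)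
open import Data.Nat.Properties
open import Data.Bool using (Bool; true; false; if_then_else_; not; _∧_; _xor_)
open import Data.Bool.Properties
  using (∧-assoc; ∧-comm; ∧-zeroʳ; ∧-identityʳ; ∧-conicalˡ; ∧-distribˡ-xor; ∧-distribʳ-xor; ∧-commutativeMonoid;
         xor-comm; xor-assoc; xor-identityʳ; xor-same; xor-∧-commutativeRing; ¬-not; if-float)
open import Data.Fin using (Fin; zero; suc; toℕ; fromℕ<; inject≤; combine; remQuot)
open import Data.Fin.Properties using (toℕ-injective; toℕ-fromℕ<; toℕ-inject≤; toℕ<n; injective⇒≤; combine-remQuot; remQuot-combine)
open import Data.Vec using (Vec; []; _∷_; _++_; take; drop; lookup; replicate; map; zipWith)
open import Data.Vec.Properties using (++-injective; take++drop≡id; tabulate∘lookup; tabulate-cong)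
open import Data.Product using (∃-syntax; _,_; proj₁; proj₂; _×_)
open import Function using (_∘_)
open import Function.Bundles using (Equivalence)
open import Relation.Binary.PropositionalEquality
open import Relation.Nullary using (yes; no; contradiction)
open import Algebra.Bundles using (CommutativeMonoid; CommutativeRing)
import Algebra.Properties.CommutativeSemigroup as CommutativeSemigroupProperties

open CommutativeSemigroupProperties (CommutativeMonoid.commutativeSemigroup ∧-commutativeMonoid)
  using () renaming (interchange to ∧-interchange)
open CommutativeSemigroupProperties (CommutativeRing.+-commutativeSemigroup xor-∧-commutativeRing)
  using () renaming (interchange to xor-interchange)
open CommutativeSemigroupProperties *-commutativeSemigroup
  using () renaming (interchange to *-interchange)

not-∧-not : ∀ a b → not a ∧ not b ≡ ((true xor a) xor b) xor (a ∧ b)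
not-∧-not false false = refl
not-∧-not false true  = refl
not-∧-not true  false = refl
not-∧-not true  true  = refl

sum₂ : (N : ℕ) → (Vec Bool N → Bool) → Bool
sum₂ zero    f = f []
sum₂ (suc N) f = sum₂ N (λ v → f (false ∷ v)) xor sum₂ N (λ v → f (true ∷ v))

sum₂-cong : ∀ N {f g : Vec Bool N → Bool} → (∀ v → f v ≡ g v) → sum₂ N f ≡ sum₂ N g
sum₂-cong zero    f≗g = f≗g []
sum₂-cong (suc N) f≗g = cong₂ _xor_ (sum₂-cong N (f≗g ∘ (false ∷_))) (sum₂-cong N (f≗g ∘ (true ∷_)))

sum₂-xor : ∀ N f g → sum₂ N (λ v → f v xor g v) ≡ sum₂ N f xor sum₂ N g
sum₂-xor zero    f g = refl
sum₂-xor (suc N) f g = trans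
  (cong₂ _xor_ (sum₂-xor N (f ∘ (false ∷_)) (g ∘ (false ∷_))) (sum₂-xor N (f ∘ (true ∷_)) (g ∘ (true ∷_))))
  (xor-interchange (sum₂ N (f ∘ (false ∷_))) (sum₂ N (g ∘ (false ∷_))) (sum₂ N (f ∘ (true ∷_))) (sum₂ N (g ∘ (true ∷_))))

sum₂-false : ∀ N → sum₂ N (λ _ → false) ≡ false
sum₂-false zero    = refl
sum₂-false (suc N) = cong₂ _xor_ (sum₂-false N) (sum₂-false N)

sum₂-∧ˡ : ∀ N b f → sum₂ N (λ v → b ∧ f v) ≡ b ∧ sum₂ N f
sum₂-∧ˡ N true  f = refl
sum₂-∧ˡ N false f = sum₂-false N

sum₂-∧ʳ : ∀ N b f → sum₂ N (λ v → f v ∧ b) ≡ sum₂ N f ∧ b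
sum₂-∧ʳ N b f = trans (sum₂-cong N (λ v → ∧-comm (f v) b)) (trans (sum₂-∧ˡ N b f) (∧-comm b (sum₂ N f)))

sum₂-swap : ∀ N M (F : Vec Bool N → Vec Bool M → Bool) →
  sum₂ N (λ u → sum₂ M (F u)) ≡ sum₂ M (λ w → sum₂ N (λ u → F u w))
sum₂-swap zero    M F = refl
sum₂-swap (suc N) M F = trans
  (cong₂ _xor_ (sum₂-swap N M (F ∘ (false ∷_))) (sum₂-swap N M (F ∘ (true ∷_))))
  (sym (sum₂-xor M (λ w → sum₂ N (λ u → F (false ∷ u) w)) (λ w → sum₂ N (λ u → F (true ∷ u) w))))

sum₂-++ : ∀ a b f → sum₂ (a + b) f ≡ sum₂ a (λ u → sum₂ b (λ w → f (u ++ w)))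
sum₂-++ zero    b f = refl
sum₂-++ (suc a) b f = cong₂ _xor_ (sum₂-++ a b (f ∘ (false ∷_))) (sum₂-++ a b (f ∘ (true ∷_)))

sum₂-true : ∀ N .{{_ : NonZero N}} → sum₂ N (λ _ → true) ≡ false
sum₂-true (suc N) = xor-same (sum₂ N (λ _ → true))

δ : ∀ {N} → Vec Bool N → Vec Bool N → Bool
δ []      []      = true
δ (a ∷ u) (b ∷ v) = not (a xor b) ∧ δ u v

≡⇒δ : ∀ {N} {u v : Vec Bool N} → u ≡ v → δ u v ≡ true
≡⇒δ {u = []}    refl = refl
≡⇒δ {u = a ∷ u} refl = trans (cong (λ c → not c ∧ δ u u) (xor-same a)) (≡⇒δ {u = u} refl)

δ⇒≡ : ∀ {N} {u v : Vec Bool N} → δ u v ≡ true → u ≡ v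
δ⇒≡ {u = []}        {[]}        _ = refl
δ⇒≡ {u = false ∷ u} {false ∷ v} e = cong (false ∷_) (δ⇒≡ e)
δ⇒≡ {u = true ∷ u}  {true ∷ v}  e = cong (true ∷_) (δ⇒≡ e)
δ⇒≡ {u = false ∷ u} {true ∷ v}  ()
δ⇒≡ {u = true ∷ u}  {false ∷ v} ()

δ-sym : ∀ {N} (u v : Vec Bool N) → δ u v ≡ δ v u
δ-sym []      []      = refl
δ-sym (a ∷ u) (b ∷ v) = cong₂ _∧_ (cong not (xor-comm a b)) (δ-sym u v)

δ-++ : ∀ {a b} (u u′ : Vec Bool a) (w w′ : Vec Bool b) → δ (u ++ w) (u′ ++ w′) ≡ δ u u′ ∧ δ w w′
δ-++ []      []       w w′ = refl
δ-++ (a ∷ u) (a′ ∷ u′) w w′ =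
  trans (cong (not (a xor a′) ∧_) (δ-++ u u′ w w′)) (sym (∧-assoc (not (a xor a′)) (δ u u′) (δ w w′)))

sum₂-∧false : ∀ N f → sum₂ N (λ v → f v ∧ false) ≡ false
sum₂-∧false N f = trans (sum₂-∧ʳ N false f) (∧-zeroʳ (sum₂ N f))

sum₂-δ : ∀ N (f : Vec Bool N → Bool) z → sum₂ N (λ v → f v ∧ δ v z) ≡ f z
sum₂-δ zero    f []          = ∧-identityʳ (f [])
sum₂-δ (suc N) f (false ∷ z) =
  trans (cong₂ _xor_ (sum₂-δ N (f ∘ (false ∷_)) z) (sum₂-∧false N (f ∘ (true ∷_)))) (xor-identityʳ (f (false ∷ z)))
sum₂-δ (suc N) f (true ∷ z)  =
  cong₂ _xor_ (sum₂-∧false N (f ∘ (false ∷_))) (sum₂-δ N (f ∘ (true ∷_)) z)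

infix 8 _·_
_·_ : ∀ {r} → Vec Bool r → Vec Bool r → Bool
[]      · []      = false
(a ∷ u) · (b ∷ v) = (a ∧ b) xor (u · v)

_⊕_ : ∀ {r} → Vec Bool r → Vec Bool r → Vec Bool r
_⊕_ = zipWith _xor_

scale : ∀ {r} → Bool → Vec Bool r → Vec Bool r
scale b = map (b ∧_)

zeros : ∀ r → Vec Bool r
zeros r = replicate r false

vsum₂ : ∀ N {r} → (Vec Bool N → Vec Bool r) → Vec Bool r
vsum₂ zero    f = f []
vsum₂ (suc N) f = vsum₂ N (f ∘ (false ∷_)) ⊕ vsum₂ N (f ∘ (true ∷_))

·-comm : ∀ {r} (u v : Vec Bool r) → u · v ≡ v · u
·-comm []      []      = refl
·-comm (a ∷ u) (b ∷ v) = cong₂ _xor_ (∧-comm a b) (·-comm u v)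

·-⊕ : ∀ {r} (u u′ w : Vec Bool r) → (u ⊕ u′) · w ≡ (u · w) xor (u′ · w)
·-⊕ []      []        []      = refl
·-⊕ (a ∷ u) (a′ ∷ u′) (b ∷ w) = trans
  (cong₂ _xor_ (∧-distribʳ-xor b a a′) (·-⊕ u u′ w))
  (xor-interchange (a ∧ b) (a′ ∧ b) (u · w) (u′ · w))

·-scale : ∀ {r} b (u w : Vec Bool r) → scale b u · w ≡ b ∧ (u · w)
·-scale b []      []      = sym (∧-zeroʳ b)
·-scale b (a ∷ u) (c ∷ w) = trans
  (cong₂ _xor_ (∧-assoc b a c) (·-scale b u w))
  (sym (∧-distribˡ-xor b (a ∧ c) (u · w)))

·-vsum₂ : ∀ N {r} (f : Vec Bool N → Vec Bool r) w → vsum₂ N f · w ≡ sum₂ N (λ v → f v · w)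
·-vsum₂ zero    f w = refl
·-vsum₂ (suc N) f w = trans
  (·-⊕ (vsum₂ N (f ∘ (false ∷_))) (vsum₂ N (f ∘ (true ∷_))) w)
  (cong₂ _xor_ (·-vsum₂ N (f ∘ (false ∷_)) w) (·-vsum₂ N (f ∘ (true ∷_)) w))

·-++ : ∀ {r s} (u v : Vec Bool r) (u′ v′ : Vec Bool s) → (u ++ u′) · (v ++ v′) ≡ (u · v) xor (u′ · v′)
·-++ []      []      u′ v′ = refl
·-++ (a ∷ u) (b ∷ v) u′ v′ =
  trans (cong ((a ∧ b) xor_) (·-++ u v u′ v′)) (sym (xor-assoc (a ∧ b) (u · v) (u′ · v′)))

·-zerosˡ : ∀ {r} (v : Vec Bool r) → zeros r · v ≡ false
·-zerosˡ []      = refl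
·-zerosˡ (b ∷ v) = ·-zerosˡ v

·-padˡ : ∀ {r s} (u : Vec Bool s) (v : Vec Bool r) w → (zeros r ++ u) · (v ++ w) ≡ u · w
·-padˡ u v w = trans (·-++ (zeros _) v u w) (cong (_xor (u · w)) (·-zerosˡ v))

·-padʳ : ∀ {r s} (u : Vec Bool r) v (w : Vec Bool s) → (u ++ zeros s) · (v ++ w) ≡ u · v
·-padʳ u v w = trans (·-++ u v (zeros _) w) (trans (cong ((u · v) xor_) (·-zerosˡ w)) (xor-identityʳ (u · v)))

-- Binary encoding {0,1}^N ≅ Fin (2^N), most significant bit first.
bit : Bool → Fin 2
bit false = zero
bit true  = suc zero

unbit : Fin 2 → Bool
unbit zero       = false
unbit (suc zero) = true

toFin : ∀ N → Vec Bool N → Fin (2 ^ N)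
toFin zero    []      = zero
toFin (suc N) (b ∷ v) = combine (bit b) (toFin N v)

fromFin : ∀ N → Fin (2 ^ N) → Vec Bool N
fromFin zero    _ = []
fromFin (suc N) i = unbit (proj₁ (remQuot (2 ^ N) i)) ∷ fromFin N (proj₂ (remQuot {2} (2 ^ N) i))

fromFin-toFin : ∀ N v → fromFin N (toFin N v) ≡ v
fromFin-toFin zero    []      = refl
fromFin-toFin (suc N) (b ∷ v) = trans
  (cong (λ p → unbit (proj₁ p) ∷ fromFin N (proj₂ p)) (remQuot-combine {2} {2 ^ N} (bit b) (toFin N v)))
  (cong₂ _∷_ (unbit-bit b) (fromFin-toFin N v))
  where
  unbit-bit : ∀ b → unbit (bit b) ≡ b
  unbit-bit false = refl
  unbit-bit true  = refl

toFin-fromFin : ∀ N i → toFin N (fromFin N i) ≡ i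
toFin-fromFin zero    zero = refl
toFin-fromFin (suc N) i    = trans
  (cong₂ combine (bit-unbit (proj₁ (remQuot {2} (2 ^ N) i))) (toFin-fromFin N (proj₂ (remQuot {2} (2 ^ N) i))))
  (combine-remQuot {2} (2 ^ N) i)
  where
  bit-unbit : ∀ i → bit (unbit i) ≡ i
  bit-unbit zero       = refl
  bit-unbit (suc zero) = refl

toFin-injective : ∀ N {u v} → toFin N u ≡ toFin N v → u ≡ v
toFin-injective N {u} {v} e = trans (sym (fromFin-toFin N u)) (trans (cong (fromFin N) e) (fromFin-toFin N v))

fromFin-injective : ∀ N {i j} → fromFin N i ≡ fromFin N j → i ≡ j
fromFin-injective N {i} {j} e = trans (sym (toFin-fromFin N i)) (trans (cong (toFin N) e) (toFin-fromFin N j))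

2^-cancel-≤ : ∀ {a b} → 2 ^ a ≤ 2 ^ b → a ≤ b
2^-cancel-≤ 2^a≤2^b = ≮⇒≥ (λ b<a → <⇒≱ (^-monoʳ-< 2 (s≤s (s≤s z≤n)) b<a) 2^a≤2^b)

cube-injection⇒≤ : ∀ {a b} (g : Vec Bool a → Vec Bool b) → (∀ {u v} → g u ≡ g v → u ≡ v) → a ≤ b
cube-injection⇒≤ {a} {b} g g-injective = 2^-cancel-≤ (injective⇒≤ {f = toFin b ∘ g ∘ fromFin a} h-injective)
  where
  h-injective : ∀ {i j} → toFin b (g (fromFin a i)) ≡ toFin b (g (fromFin a j)) → i ≡ j
  h-injective = fromFin-injective a ∘ g-injective ∘ toFin-injective b

-- A factorization of a Boolean matrix F through GF(2)^r, witnessing rank F ≤ r.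
record Factorization {X Y : Set} (r : ℕ) (F : X → Y → Bool) : Set where
  field
    row    : X → Vec Bool r
    column : Y → Vec Bool r
    factor : ∀ x y → F x y ≡ row x · column y
open Factorization

-- An involution on {0,1}^N (M² = I over GF(2)) has rank at least 2^N: the map
-- c ↦ Σₓ cₓ · row x is injective, because multiplying by M recovers c from it.
involution-rank : ∀ N {r} (M : Vec Bool N → Vec Bool N → Bool) → Factorization r M →
  (∀ x z → sum₂ N (λ y → M x y ∧ M y z) ≡ δ x z) → 2 ^ N ≤ r
involution-rank N {r} M R M²≡I = cube-injection⇒≤ combine-rows combine-rows-injective
  where
  coefficient : Vec Bool (2 ^ N) → Vec Bool N → Bool
  coefficient c x = lookup c (toFin N x)

  combine-rows : Vec Bool (2 ^ N) → Vec Bool r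
  combine-rows c = vsum₂ N (λ x → scale (coefficient c x) (row R x))

  combine-rows·column : ∀ c y → combine-rows c · column R y ≡ sum₂ N (λ x → coefficient c x ∧ M x y)
  combine-rows·column c y = trans (·-vsum₂ N _ (column R y)) (sum₂-cong N (λ x →
    trans (·-scale (coefficient c x) (row R x) (column R y)) (cong (coefficient c x ∧_) (sym (factor R x y)))))

  read-back : ∀ c z → sum₂ N (λ y → (combine-rows c · column R y) ∧ M y z) ≡ coefficient c z
  read-back c z = begin
      sum₂ N (λ y → (combine-rows c · column R y) ∧ M y z)
    ≡⟨ sum₂-cong N (λ y → cong (_∧ M y z) (combine-rows·column c y)) ⟩
      sum₂ N (λ y → sum₂ N (λ x → cₓ x ∧ M x y) ∧ M y z)
    ≡⟨ sum₂-cong N (λ y → sym (sum₂-∧ʳ N (M y z) (λ x → cₓ x ∧ M x y))) ⟩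
      sum₂ N (λ y → sum₂ N (λ x → (cₓ x ∧ M x y) ∧ M y z))
    ≡⟨ sum₂-swap N N (λ y x → (cₓ x ∧ M x y) ∧ M y z) ⟩
      sum₂ N (λ x → sum₂ N (λ y → (cₓ x ∧ M x y) ∧ M y z))
    ≡⟨ sum₂-cong N (λ x → sum₂-cong N (λ y → ∧-assoc (cₓ x) (M x y) (M y z))) ⟩
      sum₂ N (λ x → sum₂ N (λ y → cₓ x ∧ (M x y ∧ M y z)))
    ≡⟨ sum₂-cong N (λ x → trans (sum₂-∧ˡ N (cₓ x) (λ y → M x y ∧ M y z)) (cong (cₓ x ∧_) (M²≡I x z))) ⟩
      sum₂ N (λ x → cₓ x ∧ δ x z)
    ≡⟨ sum₂-δ N cₓ z ⟩
      cₓ z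
    ∎
    where
    open ≡-Reasoning
    cₓ : Vec Bool N → Bool
    cₓ = coefficient c

  combine-rows-injective : ∀ {c c′} → combine-rows c ≡ combine-rows c′ → c ≡ c′
  combine-rows-injective {c} {c′} e =
    trans (sym (tabulate∘lookup c)) (trans (tabulate-cong same-entries) (tabulate∘lookup c′))
    where
    open ≡-Reasoning
    same-entries : ∀ i → lookup c i ≡ lookup c′ i
    same-entries i = begin
        lookup c i
      ≡⟨ cong (lookup c) (sym (toFin-fromFin N i)) ⟩
        coefficient c (fromFin N i)
      ≡⟨ sym (read-back c (fromFin N i)) ⟩
        sum₂ N (λ y → (combine-rows c · column R y) ∧ M y (fromFin N i))
      ≡⟨ cong (λ w → sum₂ N (λ y → (w · column R y) ∧ M y (fromFin N i))) e ⟩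
        sum₂ N (λ y → (combine-rows c′ · column R y) ∧ M y (fromFin N i))
      ≡⟨ read-back c′ (fromFin N i) ⟩
        coefficient c′ (fromFin N i)
      ≡⟨ cong (lookup c′) (toFin-fromFin N i) ⟩
        lookup c′ i
      ∎

factorization-cong : ∀ {X Y r} {F G : X → Y → Bool} → (∀ x y → G x y ≡ F x y) →
  Factorization r F → Factorization r G
factorization-cong G≗F R = record
  { row = row R ; column = column R ; factor = λ x y → trans (G≗F x y) (factor R x y) }

restrict : ∀ {X X′ Y Y′ r} {F : X → Y → Bool} (a : X′ → X) (b : Y′ → Y) →
  Factorization r F → Factorization r (λ x y → F (a x) (b y))
restrict a b R = record { row = row R ∘ a ; column = column R ∘ b ; factor = λ x y → factor R (a x) (b y) }

transpose : ∀ {X Y r} {F : X → Y → Bool} → Factorization r F → Factorization r (λ y x → F x y)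
transpose R = record
  { row = column R ; column = row R ; factor = λ y x → trans (factor R x y) (·-comm (row R x) (column R y)) }

constant : ∀ {X Y : Set} b → Factorization 1 (λ (_ : X) (_ : Y) → b)
constant b = record
  { row = λ _ → b ∷ [] ; column = λ _ → true ∷ [] ; factor = λ _ _ → sym (trans (xor-identityʳ (b ∧ true)) (∧-identityʳ b)) }

row-select : ∀ {X Y rp rq} {Fp Fq : X → Y → Bool} (f : X → Bool) →
  Factorization rp Fp → Factorization rq Fq →
  Factorization (rp + rq) (λ x y → if f x then Fq x y else Fp x y)
row-select {rp = rp} {rq} {Fp} {Fq} f P Q = record
  { row    = λ x → if f x then zeros rp ++ row Q x else row P x ++ zeros rq
  ; column = λ y → column P y ++ column Q y
  ; factor = selected
  }
  where
  selected : ∀ x y → (if f x then Fq x y else Fp x y) ≡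
    (if f x then zeros rp ++ row Q x else row P x ++ zeros rq) · (column P y ++ column Q y)
  selected x y with f x
  ... | true  = trans (factor Q x y) (sym (·-padˡ (row Q x) (column P y) (column Q y)))
  ... | false = trans (factor P x y) (sym (·-padʳ (row P x) (column P y) (column Q y)))

column-select : ∀ {X Y rp rq} {Fp Fq : X → Y → Bool} (g : Y → Bool) →
  Factorization rp Fp → Factorization rq Fq →
  Factorization (rp + rq) (λ x y → if g y then Fq x y else Fp x y)
column-select g P Q = transpose (row-select g (transpose P) (transpose Q))

two-subtrees : ∀ {rp rq} cp cq → rp ≤ 2 ^ cp → rq ≤ 2 ^ cq → rp + rq ≤ 2 ^ suc (cp ⊔ cq)
two-subtrees cp cq rp≤ rq≤ = ≤-trans
  (+-mono-≤ (≤-trans rp≤ (^-monoʳ-≤ 2 (m≤m⊔n cp cq))) (≤-trans rq≤ (^-monoʳ-≤ 2 (m≤n⊔m cp cq))))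
  (≤-reflexive (cong (2 ^ (cp ⊔ cq) +_) (sym (+-identityʳ _))))

protocol-rank : ∀ {X Y} (g : Bool → Bool) (P : Protocol X Y) →
  ∃[ r ] (r ≤ 2 ^ cost P × Factorization r (λ x y → g (run P x y)))
protocol-rank g (leaf b) = 1 , ≤-refl , constant (g b)
protocol-rank g (alice f p q) with protocol-rank g p | protocol-rank g q
... | rp , rp≤ , P | rq , rq≤ , Q =
  rp + rq , two-subtrees (cost p) (cost q) rp≤ rq≤ , factorization-cong (λ x y → if-float g (f x)) (row-select f P Q)
protocol-rank g (bob f p q) with protocol-rank g p | protocol-rank g q
... | rp , rp≤ , P | rq , rq≤ , Q =
  rp + rq , two-subtrees (cost p) (cost q) rp≤ rq≤ , factorization-cong (λ x y → if-float g (f y)) (column-select f P Q)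

take-++ : ∀ {A : Set} {a b} (u : Vec A a) (w : Vec A b) → take a (u ++ w) ≡ u
take-++ {a = a} u w = proj₁ (++-injective (take a (u ++ w)) u (take++drop≡id a (u ++ w)))

drop-++ : ∀ {A : Set} {a b} (u : Vec A a) (w : Vec A b) → drop a (u ++ w) ≡ w
drop-++ {a = a} u w = proj₂ (++-injective (take a (u ++ w)) u (take++drop≡id a (u ++ w)))

module Blocks (m : ℕ) where

  block : ∀ J → Vec Bool (J * m) → Fin J → Vec Bool m
  block (suc J) x zero    = take m x
  block (suc J) x (suc j) = block J (drop m x) j

  apart : ∀ J → Vec Bool (J * m) → Vec Bool (J * m) → Bool
  apart zero    _ _ = true
  apart (suc J) x y = not (δ (take m x) (take m y)) ∧ apart J (drop m x) (drop m y)

  apart-true : ∀ J {x y} → apart J x y ≡ true → ∀ j → block J x j ≢ block J y j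
  apart-true (suc J) apart≡true zero same =
    contradiction (trans (sym (cong not (≡⇒δ same))) (∧-conicalˡ _ _ apart≡true)) λ ()
  -- (when the first blocks agree, apart≡true is already absurd)
  apart-true (suc J) {x} {y} apart≡true (suc j) same with δ (take m x) (take m y)
  ... | false = apart-true J apart≡true j same

  apart-false : ∀ J {x y} → apart J x y ≡ false → ∃[ j ] (block J x j ≡ block J y j)
  apart-false (suc J) {x} {y} apart≡false with δ (take m x) (take m y) in heads-equal
  ... | true  = zero , δ⇒≡ heads-equal
  ... | false with apart-false J apart≡false
  ...   | j , same = suc j , same

  -- (J − I)² = I over GF(2) for the all-ones matrix J on {0,1}^m, m ≥ 1:
  -- Σᵤ [a ≠ u][u ≠ b] = 2^m − 2 + [a = b] ≡ [a = b] (mod 2).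
  differ-square : .{{_ : NonZero m}} → ∀ a b → sum₂ m (λ u → not (δ a u) ∧ not (δ u b)) ≡ δ a b
  differ-square a b = begin
      sum₂ m (λ u → not (δ a u) ∧ not (δ u b))
    ≡⟨ sum₂-cong m (λ u → not-∧-not (δ a u) (δ u b)) ⟩
      sum₂ m (λ u → ((true xor δ a u) xor δ u b) xor (δ a u ∧ δ u b))
    ≡⟨ sum₂-xor m (λ u → (true xor δ a u) xor δ u b) (λ u → δ a u ∧ δ u b) ⟩
      sum₂ m (λ u → (true xor δ a u) xor δ u b) xor sum₂ m (λ u → δ a u ∧ δ u b)
    ≡⟨ cong₂ _xor_ linear-part quadratic-part ⟩
      δ a b
    ∎
    where
    open ≡-Reasoning
    linear-part : sum₂ m (λ u → (true xor δ a u) xor δ u b) ≡ false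
    linear-part = begin
        sum₂ m (λ u → (true xor δ a u) xor δ u b)
      ≡⟨ sum₂-xor m (λ u → true xor δ a u) (λ u → δ u b) ⟩
        sum₂ m (λ u → true xor δ a u) xor sum₂ m (λ u → δ u b)
      ≡⟨ cong (_xor sum₂ m (λ u → δ u b)) (sum₂-xor m (λ _ → true) (δ a)) ⟩
        (sum₂ m (λ _ → true) xor sum₂ m (δ a)) xor sum₂ m (λ u → δ u b)
      ≡⟨ cong₂ _xor_ (cong₂ _xor_ (sum₂-true m) (trans (sum₂-cong m (δ-sym a)) (sum₂-δ m (λ _ → true) a)))
                     (sum₂-δ m (λ _ → true) b) ⟩
        (false xor true) xor true
      ∎
    quadratic-part : sum₂ m (λ u → δ a u ∧ δ u b) ≡ δ a b
    quadratic-part = trans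
      (sum₂-cong m (λ u → trans (cong (_∧ δ u b) (δ-sym a u)) (∧-comm (δ u a) (δ u b))))
      (sum₂-δ m (λ u → δ u b) a)

  -- Hence the matrix 'apart J', the J-th tensor power of J − I, is an involution.
  apart-square : .{{_ : NonZero m}} → ∀ J x z → sum₂ (J * m) (λ y → apart J x y ∧ apart J y z) ≡ δ x z
  apart-square zero    []  []  = refl
  apart-square (suc J) x z = begin
      sum₂ (m + J * m) (λ y → apart (suc J) x y ∧ apart (suc J) y z)
    ≡⟨ sum₂-++ m (J * m) (λ y → apart (suc J) x y ∧ apart (suc J) y z) ⟩
      sum₂ m (λ u → sum₂ (J * m) (λ w → apart (suc J) x (u ++ w) ∧ apart (suc J) (u ++ w) z))
    ≡⟨ sum₂-cong m (λ u → sum₂-cong (J * m) (λ w → split u w)) ⟩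
      sum₂ m (λ u → sum₂ (J * m) (λ w → first u ∧ rest w))
    ≡⟨ sum₂-cong m (λ u → sum₂-∧ˡ (J * m) (first u) rest) ⟩
      sum₂ m (λ u → first u ∧ sum₂ (J * m) rest)
    ≡⟨ sum₂-∧ʳ m (sum₂ (J * m) rest) first ⟩
      sum₂ m first ∧ sum₂ (J * m) rest
    ≡⟨ cong₂ _∧_ (differ-square (take m x) (take m z)) (apart-square J (drop m x) (drop m z)) ⟩
      δ (take m x) (take m z) ∧ δ (drop m x) (drop m z)
    ≡⟨ sym (δ-++ (take m x) (take m z) (drop m x) (drop m z)) ⟩
      δ (take m x ++ drop m x) (take m z ++ drop m z)
    ≡⟨ cong₂ δ (take++drop≡id m x) (take++drop≡id m z) ⟩
      δ x z
    ∎
    where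
    open ≡-Reasoning
    first : Vec Bool m → Bool
    first u = not (δ (take m x) u) ∧ not (δ u (take m z))
    rest : Vec Bool (J * m) → Bool
    rest w = apart J (drop m x) w ∧ apart J w (drop m z)
    split : ∀ u w → apart (suc J) x (u ++ w) ∧ apart (suc J) (u ++ w) z ≡ first u ∧ rest w
    split u w rewrite take-++ u w | drop-++ u w =
      ∧-interchange (not (δ (take m x) u)) (apart J (drop m x) w) (not (δ u (take m z))) (apart J w (drop m z))

clamp : ∀ {k K} → Fin K → Fin k → Fin K
clamp {K = K} d i with toℕ i <? K
... | yes i<K = fromℕ< i<K
... | no  _   = d

clamp-inject≤ : ∀ {k K} (d : Fin K) (K≤k : K ≤ k) j → clamp d (inject≤ j K≤k) ≡ j
clamp-inject≤ {K = K} d K≤k j with toℕ (inject≤ j K≤k) <? K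
... | yes i<K = toℕ-injective (trans (toℕ-fromℕ< i<K) (toℕ-inject≤ j K≤k))
... | no  i≮K = contradiction (subst (_< K) (sym (toℕ-inject≤ j K≤k)) (toℕ<n j)) i≮K

module Embedding (L m : ℕ) where
  open Blocks m

  K : ℕ
  K = 2 ^ L

  named-block : Vec Bool (K * m) → Fin K → Vec Bool (L + m)
  named-block x j = fromFin L j ++ block K x j

  position : ∀ {k} → Fin k → Fin K
  position = clamp (toFin L (zeros L))

  strings : ∀ {k} → Vec Bool (K * m) → Strings k (L + m)
  strings x = named-block x ∘ position

  -- The names make a collision happen at equal positions.
  collision⇒agreement : ∀ {k k′} x y → Collide {k} {k′} (strings x) (strings y) →
    ∃[ j ] (block K x j ≡ block K y j)
  collision⇒agreement x y (i , i′ , same) =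
    position i , trans (proj₂ halves) (cong (block K y) (sym (fromFin-injective L (proj₁ halves))))
    where
    halves = ++-injective (fromFin L (position i)) (fromFin L (position i′)) same

  agreement⇒collision : ∀ {k k′} → K ≤ k → K ≤ k′ → ∀ x y j → block K x j ≡ block K y j →
    Collide {k} {k′} (strings x) (strings y)
  agreement⇒collision K≤k K≤k′ x y j same = inject≤ j K≤k , inject≤ j K≤k′ , (begin
      named-block x (position (inject≤ j K≤k))
    ≡⟨ cong (named-block x) (clamp-inject≤ _ K≤k j) ⟩
      fromFin L j ++ block K x j
    ≡⟨ cong (fromFin L j ++_) same ⟩
      fromFin L j ++ block K y j
    ≡⟨ cong (named-block y) (clamp-inject≤ _ K≤k′ j) ⟨
      named-block y (position (inject≤ j K≤k′))
    ∎)
    where open ≡-Reasoning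

  complement-is-apart : ∀ {k k′} → K ≤ k → K ≤ k′ → (P : Protocol (Strings k (L + m)) (Strings k′ (L + m))) →
    SolvesDISJ P → ∀ x y → not (run P (strings x) (strings y)) ≡ apart K x y
  complement-is-apart K≤k K≤k′ P solves x y with apart K x y in apart≡
  ... | true  = cong not (¬-not λ outputs-true →
    let j , same = collision⇒agreement x y (Equivalence.to (solves _ _) outputs-true)
    in apart-true K apart≡ j same)
  ... | false = cong not (Equivalence.from (solves _ _)
    (agreement⇒collision K≤k K≤k′ x y (proj₁ (apart-false K apart≡)) (proj₂ (apart-false K apart≡))))

  reduction-bound : .{{_ : NonZero m}} → ∀ {k k′ n} → L + m ≡ n → K ≤ k → K ≤ k′ →
    (P : Protocol (Strings k n) (Strings k′ n)) → SolvesDISJ P → K * m ≤ cost P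
  reduction-bound refl K≤k K≤k′ P solves with protocol-rank not P
  ... | r , r≤2^cost , R = 2^-cancel-≤ (≤-trans (involution-rank (K * m) (apart K) apart-factorization (apart-square K)) r≤2^cost)
    where
    apart-factorization : Factorization r (apart K)
    apart-factorization = factorization-cong (λ x y → sym (complement-is-apart K≤k K≤k′ P solves x y))
                                             (restrict strings strings R)

binary-magnitude : ∀ t → ∃[ L ] (2 ^ L ≤ suc t × suc t < 2 ^ suc L)
binary-magnitude zero = 0 , ≤-refl , s≤s (s≤s z≤n)
binary-magnitude (suc t) with binary-magnitude t
... | L , lower , upper with suc (suc t) <? 2 ^ suc L
...   | yes below  = L , m≤n⇒m≤1+n lower , below
...   | no  ¬below = suc L , ≮⇒≥ ¬below , ≤-<-trans upper (^-monoʳ-< 2 (s≤s (s≤s z≤n)) (n<1+n (suc L)))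

half-bound : ∀ L n → L + L ≤ suc n → L ≤ n
half-bound zero    n _         = z≤n
half-bound (suc L) n (s≤s L+L) = ≤-trans (m≤n+m (suc L) L) L+L

-- Choice of parameters: for s = t + 1 with s² ≤ 2^(n+1), take 2^L ≤ s < 2^(L+1)
-- and m = n + 1 − L; then m ≥ 1, m ≥ L and hence s·(n + 1) ≤ 4·(2^L·m).
block-parameters : ∀ t n → suc t ^ 2 ≤ 2 ^ suc n →
  ∃[ L ] ∃[ m ] (L + suc m ≡ suc n × 2 ^ L ≤ suc t × suc t * suc n ≤ 4 * (2 ^ L * suc m))
block-parameters t n s²≤2^n with binary-magnitude t
... | L , 2^L≤s , s<2^L+1 = L , n ∸ L , L+m≡n , 2^L≤s , s*n≤
  where
  open ≤-Reasoning
  L+L≤n : L + L ≤ suc n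
  L+L≤n = 2^-cancel-≤ (begin
      2 ^ (L + L)      ≡⟨ ^-distribˡ-+-* 2 L L ⟩
      2 ^ L * 2 ^ L    ≤⟨ *-mono-≤ 2^L≤s (≤-trans 2^L≤s (≤-reflexive (sym (*-identityʳ (suc t))))) ⟩
      suc t ^ 2        ≤⟨ s²≤2^n ⟩
      2 ^ suc n        ∎)
  L+m≡n : L + suc (n ∸ L) ≡ suc n
  L+m≡n = trans (+-suc L (n ∸ L)) (cong suc (m+[n∸m]≡n (half-bound L n L+L≤n)))
  n≤2m : suc n ≤ 2 * suc (n ∸ L)
  n≤2m = begin
      suc n                          ≡⟨ L+m≡n ⟨
      L + suc (n ∸ L)                ≤⟨ +-monoˡ-≤ (suc (n ∸ L)) (+-cancelˡ-≤ L L _ (subst (L + L ≤_) (sym L+m≡n) L+L≤n)) ⟩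
      suc (n ∸ L) + suc (n ∸ L)      ≡⟨ cong (suc (n ∸ L) +_) (+-identityʳ (suc (n ∸ L))) ⟨
      2 * suc (n ∸ L)                ∎
  s*n≤ : suc t * suc n ≤ 4 * (2 ^ L * suc (n ∸ L))
  s*n≤ = begin
      suc t * suc n                      ≤⟨ *-mono-≤ (<⇒≤ s<2^L+1) n≤2m ⟩
      (2 * 2 ^ L) * (2 * suc (n ∸ L))    ≡⟨ *-interchange 2 (2 ^ L) 2 (suc (n ∸ L)) ⟩
      4 * (2 ^ L * suc (n ∸ L))          ∎

disjointness-bound : ∀ {k k′ n} → (k ⊓ k′) ^ 2 ≤ 2 ^ n →
  (P : Protocol (Strings k n) (Strings k′ n)) → SolvesDISJ P → (k ⊓ k′) * n ≤ 4 * cost P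
disjointness-bound {k} {k′} {zero} _ _ _ = ≤-trans (≤-reflexive (*-zeroʳ (k ⊓ k′))) z≤n
disjointness-bound {k} {k′} {suc n} s²≤2^n P solves with k ⊓ k′ in s≡
... | zero  = z≤n
... | suc t with block-parameters t n s²≤2^n
...   | L , m , L+m≡n , 2^L≤s , s*n≤ = ≤-trans s*n≤ (*-monoʳ-≤ 4
  (Embedding.reduction-bound L (suc m) L+m≡n (≤-trans 2^L≤s (subst (_≤ k) s≡ (m⊓n≤m k k′)))
                                             (≤-trans 2^L≤s (subst (_≤ k′) s≡ (m⊓n≤n k k′))) P solves))

-- Theorem: DISJ_n^{k,k'} with k, k' = 2^{o(n)} needs Ω(min(k,k')·n) bits; the
-- constant is 4, and only k(n)² ≤ 2^n for large n is used.
theoremA1 : (k k' : ℕ → ℕ) → SubExp k → SubExp k' →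
    ∃[ c ] ∃[ N ] (∀ n → N ≤ n →
    (P : Protocol (Strings (k n) n) (Strings (k' n) n)) → SolvesDISJ P →
    (k n ⊓ k' n) * n ≤ suc c * cost P)
theoremA1 k k' k-subexp _ = 3 , proj₁ (k-subexp 1) , λ n N≤n →
  disjointness-bound (≤-trans (^-monoˡ-≤ 2 (m⊓n≤m (k n) (k' n))) (proj₂ (k-subexp 1) n N≤n))
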